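{- Let $p$ be a prime number. Then $\mathbb{Z}[\gamma_p(\mathbb{Q})]\subsetneqq\mathbb{Z}_{(p)}$.
   Context: $\gamma_p(X)=\frac1p\cdot\frac{X^p-X}{(X^p-X)^2-1}$, and $\gamma_p(\mathbb{Q})$ is the set of values $\gamma_p(x)$ for $x\in\mathbb{Q}$ not a pole of $\gamma_p$; $\mathbb{Z}[\gamma_p(\mathbb{Q})]$ is the subring of $\mathbb{Q}$ generated by this set, and $\mathbb{Z}_{(p)}$ is the localization of $\mathbb{Z}$ at $p$. -}

module Defs where

open import Data.Nat as ℕ using (ℕ; zero; suc)
open import Data.Nat.Divisibility using (_∣_)
open import Data.Integer using (+_)
open import Data.Rational
  using (ℚ; 0ℚ; 1ℚ; _+_; _*_; _-_; -_; _÷_; _/_; ≢-nonZero; ↧ₙ_)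
open import Relation.Binary.PropositionalEquality using (_≡_; _≢_)
open import Relation.Nullary using (¬_)

_^ℚ_ : ℚ → ℕ → ℚ
x ^ℚ zero    = 1ℚ
x ^ℚ suc n   = x * (x ^ℚ n)

uₚ : ℕ → ℚ → ℚ
uₚ p x = (x ^ℚ p) - x

denₚ : ℕ → ℚ → ℚ
denₚ p x = (uₚ p x * uₚ p x) - 1ℚ

γ : (p : ℕ) .{{_ : ℕ.NonZero p}} → (x : ℚ) → denₚ p x ≢ 0ℚ → ℚ
γ p x h = ((+ 1) / p) * (_÷_ (uₚ p x) (denₚ p x) {{≢-nonZero h}})

data InZγ (p : ℕ) .{{_ : ℕ.NonZero p}} : ℚ → Set where
  gen  : (x : ℚ) (h : denₚ p x ≢ 0ℚ) → InZγ p (γ p x h)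
  one  : InZγ p 1ℚ
  add  : ∀ {a b} → InZγ p a → InZγ p b → InZγ p (a + b)
  neg  : ∀ {a} → InZγ p a → InZγ p (- a)
  mul  : ∀ {a b} → InZγ p a → InZγ p b → InZγ p (a * b)

InZₚ : ℕ → ℚ → Set
InZₚ p q = ¬ (p ∣ ↧ₙ q)

{-# OPTIONS --safe #-}
-- For x = n/d in lowest terms put U = nᵖ - n·dᵖ⁻¹, D = dᵖ and W = U² - D²; clearing
-- denominators gives γₚ(x) = U·D / (p·W). So γₚ(x) lies in ℤ₍l₎ for a prime l with l ∤ W
-- as soon as l ∤ p or l ∣ U·D, and ℤ₍l₎ is a ring. For l = p: if p ∣ d then p ∤ W, for
-- otherwise p ∣ U and hence p ∣ n; if p ∤ d, Fermat's little theorem gives p ∣ U, so that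
-- W ≡ -D² ≢ 0. For strictness, a prime l ≠ p with l ∤ W for all coprime n, d puts
-- 1/l ∈ ℤ₍p₎ outside ℤ[γₚ(ℚ)]: l = 2 works for odd p (the same argument, with i ≡ iᵖ mod 2),
-- and l = 17 for p = 2.
module Submission where

open import Defs
open import Data.Nat as ℕ using (ℕ; zero; suc; 2+; NonZero; _<_; _∸_; _!)
import Data.Nat.Properties as ℕP
import Data.Nat.Divisibility as ℕ∣
open import Data.Nat.DivMod using (m/n*n≡m)
open import Data.Nat.Primality
  using (Prime; euclidsLemma; prime⇒nonTrivial; prime⇒nonZero; prime⇒irreducible; prime?; ¬prime[1]; prime[2])
open import Data.Nat.Combinatorics using (_C_; nCn≡1; k![n∸k]!∣n!)
open import Data.Nat.Combinatorics.Specification using (nCk≡n!/k![n-k]!)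
open import Data.Fin as Fin using (Fin; toℕ; fromℕ; inject₁)
import Data.Fin.Properties as FinP
open import Data.Integer as ℤ using (ℤ; +_; -[1+_]; +[1+_]; 0ℤ; 1ℤ; _+_; _*_; _-_; _^_)
import Data.Integer.Properties as ℤP
open import Data.Integer.DivMod using (_%ℕ_; _/ℕ_; n%ℕd<d; a≡a%ℕn+[a/ℕn]*n)
open import Data.Integer.Coprimality using (Coprime; coprime-divisor)
open import Data.Integer.Divisibility.Signed
  using (_∣_; divides; _∣?_; ∣ᵤ⇒∣; ∣⇒∣ᵤ; ∣m∣n⇒∣m+n; ∣m∣n⇒∣m-n; ∣m+n∣m⇒∣n; ∣n⇒∣m*n; ∣m⇒∣m*n; ∣m⇒∣-m)
open import Data.Integer.Tactic.RingSolver using (solve-∀)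
import Data.Nat.Coprimality as ℕCoprimality
open import Data.Rational as ℚ using (ℚ; mkℚ; 0ℚ; 1ℚ; _/_; 1/_; ↥_; ↧_; ↧ₙ_; ≢-nonZero)
open import Data.Rational.Literals using (fromℤ)
import Data.Rational.Properties as ℚP
import Data.Rational.Unnormalised as ℚᵘ
import Data.Rational.Unnormalised.Properties as ℚᵘP
open import Data.Rational.Solver using (module +-*-Solver)
open +-*-Solver using (solve; _:+_; _:*_; _:-_; _:=_; con)
open import Algebra.Bundles using (CommutativeMonoid)
open import Algebra.Properties.CommutativeSemigroup (CommutativeMonoid.commutativeSemigroup ℚP.*-1-commutativeMonoid)
  using (interchange; xy∙z≈xz∙y; x∙yz≈y∙xz)
import Algebra.Properties.CommutativeSemiring.Binomial as Binomial
import Algebra.Properties.Monoid.Sum as MonoidSum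
open import Algebra.Definitions.RawSemiring ℤ.+-*-rawSemiring using (sum) renaming (_^_ to _^ᴿ_; _×_ to _×ᴿ_)
open import Data.Empty using (⊥-elim)

open import Data.Sum as Sum using (_⊎_; [_,_]′)
open import Data.Product using (_×_; ∃; _,_; proj₂; uncurry)
open import Function using (id; _∘_)
open import Relation.Nullary using (¬_; yes; no)
open import Relation.Nullary.Decidable using (toWitness; toWitnessFalse; from-yes; ¬?; _→-dec_)
open import Relation.Binary.PropositionalEquality

n∣n! : ∀ n .{{_ : NonZero n}} → n ℕ∣.∣ n !
n∣n! (suc m) = ℕ∣.m∣m*n (m !)

module _ {p : ℕ} (p-prime : Prime p) where

  prime∤1 : ¬ p ℕ∣.∣ 1
  prime∤1 p∣1 = ℕP.<-irrefl (sym (ℕ∣.∣1⇒≡1 p∣1)) (ℕ.nonTrivial⇒n>1 p {{prime⇒nonTrivial p-prime}})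

  prime∤* : ∀ {m n} → ¬ p ℕ∣.∣ m → ¬ p ℕ∣.∣ n → ¬ p ℕ∣.∣ m ℕ.* n
  prime∤* {m} {n} p∤m p∤n = [ p∤m , p∤n ]′ ∘ euclidsLemma m n p-prime

  prime∤! : ∀ m → m < p → ¬ p ℕ∣.∣ m !
  prime∤! zero    _     = prime∤1
  prime∤! (suc m) 1+m<p = prime∤* (λ p∣1+m → ℕP.<⇒≱ 1+m<p (ℕ∣.∣⇒≤ p∣1+m))
                                  (prime∤! m (ℕP.<-trans (ℕP.n<1+n m) 1+m<p))

  prime∣pCk : ∀ k → 0 < k → k < p → p ℕ∣.∣ p C k
  prime∣pCk k 0<k k<p =
    [ id , ⊥-elim ∘ prime∤* (prime∤! k k<p) (prime∤! (p ∸ k) (ℕP.∸-monoʳ-< 0<k k≤p)) ]′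
      (euclidsLemma (p C k) _ p-prime (subst (p ℕ∣.∣_) (sym pCk*k![p∸k]!≡p!) p∣p!))
    where
    k≤p = ℕP.<⇒≤ k<p
    p∣p! = n∣n! p {{prime⇒nonZero p-prime}}
    instance _ = k ℕP.!* (p ∸ k) !≢0
    pCk*k![p∸k]!≡p! : (p C k) ℕ.* (k ! ℕ.* (p ∸ k) !) ≡ p !
    pCk*k![p∸k]!≡p! =
      trans (cong (ℕ._* (k ! ℕ.* (p ∸ k) !)) (nCk≡n!/k![n-k]! k≤p)) (m/n*n≡m (k![n∸k]!∣n! k≤p))

  euclidsLemmaℤ : ∀ i j → + p ∣ i * j → + p ∣ i ⊎ + p ∣ j
  euclidsLemmaℤ i j p∣ij = Sum.map ∣ᵤ⇒∣ ∣ᵤ⇒∣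
    (euclidsLemma ℤ.∣ i ∣ ℤ.∣ j ∣ p-prime (subst (p ℕ∣.∣_) (ℤP.abs-* i j) (∣⇒∣ᵤ p∣ij)))

  prime∤ℤ* : ∀ {i j} → ¬ + p ∣ i → ¬ + p ∣ j → ¬ + p ∣ i * j
  prime∤ℤ* {i} {j} p∤i p∤j = [ p∤i , p∤j ]′ ∘ euclidsLemmaℤ i j

  prime∣i*j∧∤i⇒∣j : ∀ {i j} → + p ∣ i * j → ¬ + p ∣ i → + p ∣ j
  prime∣i*j∧∤i⇒∣j {i} {j} p∣ij p∤i = [ ⊥-elim ∘ p∤i , id ]′ (euclidsLemmaℤ i j p∣ij)

  prime∣²⇒∣ : ∀ i → + p ∣ i * i → + p ∣ i
  prime∣²⇒∣ i = [ id , id ]′ ∘ euclidsLemmaℤ i i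

  prime∣^⇒∣ : ∀ i k → + p ∣ i ^ k → + p ∣ i
  prime∣^⇒∣ i zero    = ⊥-elim ∘ prime∤1 ∘ ∣⇒∣ᵤ
  prime∣^⇒∣ i (suc k) = [ id , prime∣^⇒∣ i k ]′ ∘ euclidsLemmaℤ i (i ^ k)

^ᴿ≡^ : ∀ i n → i ^ᴿ n ≡ i ^ n
^ᴿ≡^ i zero    = refl
^ᴿ≡^ i (suc n) = cong (i *_) (^ᴿ≡^ i n)

×ᴿ≡* : ∀ n i → n ×ᴿ i ≡ + n * i
×ᴿ≡* zero    i = sym (ℤP.*-zeroˡ i)
×ᴿ≡* (suc n) i = trans (cong (ℤ._+_ i) (×ᴿ≡* n i)) (sym (ℤP.suc-* (+ n) i))

∣-sum : ∀ {k n} (f : Fin n → ℤ) → (∀ i → k ∣ f i) → k ∣ sum f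
∣-sum {n = zero}  f _    = divides 0ℤ refl
∣-sum {n = suc n} f k∣fᵢ = ∣m∣n⇒∣m+n (k∣fᵢ Fin.zero) (∣-sum (f ∘ Fin.suc) (k∣fᵢ ∘ Fin.suc))

open Binomial ℤP.+-*-commutativeSemiring using (binomial; binomialTerm) renaming (theorem to binomialTheorem)
open MonoidSum ℤP.+-0-monoid using (sum-init-last)

freshman'sDream : ∀ {p} → Prime p → ∀ i → + p ∣ (1ℤ + i) ^ p - (1ℤ + i ^ p)
freshman'sDream {suc q} p-prime i = subst (+ p ∣_) (sym dream≡middle) (∣-sum (T ∘ Fin.suc ∘ inject₁) p∣T)
  where
  p = suc q
  T = binomialTerm 1ℤ i p
  middle = sum (T ∘ Fin.suc ∘ inject₁)
  T₀≡iᵖ : T Fin.zero ≡ i ^ p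
  T₀≡iᵖ = trans (ℤP.+-identityʳ _) (trans (ℤP.*-identityˡ _) (^ᴿ≡^ i p))
  Tₚ≡1 : T (Fin.suc (fromℕ q)) ≡ 1ℤ
  Tₚ≡1 = begin
    (p C suc (toℕ (fromℕ q))) ×ᴿ (1ℤ ^ᴿ suc (toℕ (fromℕ q)) * i ^ᴿ (q ∸ toℕ (fromℕ q)))
      ≡⟨ cong (λ k → (p C suc k) ×ᴿ (1ℤ ^ᴿ suc k * i ^ᴿ (q ∸ k))) (FinP.toℕ-fromℕ q) ⟩
    (p C p) ×ᴿ (1ℤ ^ᴿ p * i ^ᴿ (q ∸ q))
      ≡⟨ cong₂ (λ c k → c ×ᴿ (1ℤ ^ᴿ p * i ^ᴿ k)) (nCn≡1 p) (ℕP.n∸n≡0 q) ⟩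
    1 ×ᴿ (1ℤ ^ᴿ p * 1ℤ)
      ≡⟨ trans (ℤP.+-identityʳ _) (trans (ℤP.*-identityʳ _) (trans (^ᴿ≡^ 1ℤ p) (ℤP.^-zeroˡ p))) ⟩
    1ℤ ∎
    where open ≡-Reasoning
  expand : (1ℤ + i) ^ p ≡ i ^ p + (middle + 1ℤ)
  expand = begin
    (1ℤ + i) ^ p                                  ≡⟨ sym (^ᴿ≡^ (1ℤ + i) p) ⟩
    (1ℤ + i) ^ᴿ p                                 ≡⟨ binomialTheorem p 1ℤ i ⟩
    T Fin.zero + sum (T ∘ Fin.suc)                ≡⟨ cong (λ s → T Fin.zero + s) (sum-init-last (T ∘ Fin.suc)) ⟩
    T Fin.zero + (middle + T (Fin.suc (fromℕ q))) ≡⟨ cong₂ (λ a b → a + (middle + b)) T₀≡iᵖ Tₚ≡1 ⟩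
    i ^ p + (middle + 1ℤ)                         ∎
    where open ≡-Reasoning
  rearrange : ∀ a m → (a + (m + 1ℤ)) - (1ℤ + a) ≡ m
  rearrange = solve-∀
  dream≡middle : (1ℤ + i) ^ p - (1ℤ + i ^ p) ≡ middle
  dream≡middle = trans (cong (_- (1ℤ + i ^ p)) expand) (rearrange (i ^ p) middle)
  p∣T : ∀ j → + p ∣ T (Fin.suc (inject₁ j))
  p∣T j = subst (+ p ∣_) (sym (×ᴿ≡* (p C suc k) b))
    (∣m⇒∣m*n b (∣ᵤ⇒∣ {+ p} {+ (p C suc k)} (prime∣pCk p-prime (suc k) (ℕ.s≤s ℕ.z≤n) (ℕ.s≤s k<q))))
    where
    k = toℕ (inject₁ j)
    b = binomial 1ℤ i p (Fin.suc (inject₁ j))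
    k<q : k < q
    k<q = subst (_< q) (sym (FinP.toℕ-inject₁ j)) (FinP.toℕ<n j)

fermat'sLittleTheorem : ∀ {p} → Prime p → ∀ i → + p ∣ i ^ p - i
fermat'sLittleTheorem {suc q} p-prime = fermat
  where
  p = suc q
  shift : ∀ i → (1ℤ + i) ^ p - (1ℤ + i) ≡ ((1ℤ + i) ^ p - (1ℤ + i ^ p)) + (i ^ p - i)
  shift i = lemma ((1ℤ + i) ^ p) (i ^ p) i
    where
    lemma : ∀ a b i → a - (1ℤ + i) ≡ (a - (1ℤ + b)) + (b - i)
    lemma = solve-∀
  up : ∀ i → + p ∣ i ^ p - i → + p ∣ (1ℤ + i) ^ p - (1ℤ + i)
  up i p∣ = subst (+ p ∣_) (sym (shift i)) (∣m∣n⇒∣m+n (freshman'sDream p-prime i) p∣)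
  down : ∀ i → + p ∣ (1ℤ + i) ^ p - (1ℤ + i) → + p ∣ i ^ p - i
  down i p∣ = ∣m+n∣m⇒∣n (subst (+ p ∣_) (shift i) p∣) (freshman'sDream p-prime i)
  fermat : ∀ i → + p ∣ i ^ p - i
  fermat (+ zero)      = divides 0ℤ refl
  fermat +[1+ n ]      = up (+ n) (fermat (+ n))
  -- 1ℤ + -[1+ suc n ] reduces to -[1+ n ]
  fermat -[1+ zero ]   = down -[1+ zero ] (fermat (+ zero))
  fermat -[1+ suc n ]  = down -[1+ suc n ] (fermat -[1+ n ])

2∣i^[1+k]-i : ∀ k i → + 2 ∣ i ^ suc k - i
2∣i^[1+k]-i zero    i = subst (+ 2 ∣_) (sym (lemma i)) (divides 0ℤ refl)
  where
  lemma : ∀ i → i * 1ℤ - i ≡ 0ℤ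
  lemma = solve-∀
2∣i^[1+k]-i (suc k) i =
  subst (+ 2 ∣_) (sym (lemma i (i ^ suc k)))
        (∣m∣n⇒∣m+n (∣n⇒∣m*n i (2∣i^[1+k]-i k i)) (fermat'sLittleTheorem prime[2] i))
  where
  lemma : ∀ i iᵏ → i * iᵏ - i ≡ i * (iᵏ - i) + (i * (i * 1ℤ) - i)
  lemma = solve-∀

infix 4 _≡_mod_

record _≡_mod_ (i j : ℤ) (m : ℕ) : Set where
  constructor ≡-mod
  field
    m∣i-j : + m ∣ i - j

module _ {m : ℕ} where

  ≡-mod-sym : ∀ {i j} → i ≡ j mod m → j ≡ i mod m
  ≡-mod-sym {i} {j} (≡-mod m∣i-j) = ≡-mod (subst (+ m ∣_) (lemma i j) (∣m⇒∣-m m∣i-j))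
    where
    lemma : ∀ i j → ℤ.- (i - j) ≡ j - i
    lemma = solve-∀

  ≡-mod-∣ : ∀ {i j} → i ≡ j mod m → + m ∣ i → + m ∣ j
  ≡-mod-∣ {i} {j} (≡-mod m∣i-j) m∣i = subst (+ m ∣_) (lemma i j) (∣m∣n⇒∣m-n m∣i m∣i-j)
    where
    lemma : ∀ i j → i - (i - j) ≡ j
    lemma = solve-∀

  ≡-mod-- : ∀ {i i′ j j′} → i ≡ i′ mod m → j ≡ j′ mod m → i - j ≡ i′ - j′ mod m
  ≡-mod-- {i} {i′} {j} {j′} (≡-mod m∣i-i′) (≡-mod m∣j-j′) =
    ≡-mod (subst (+ m ∣_) (sym (lemma i i′ j j′)) (∣m∣n⇒∣m-n m∣i-i′ m∣j-j′))
    where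
    lemma : ∀ i i′ j j′ → (i - j) - (i′ - j′) ≡ (i - i′) - (j - j′)
    lemma = solve-∀

  ≡-mod-* : ∀ {i i′ j j′} → i ≡ i′ mod m → j ≡ j′ mod m → i * j ≡ i′ * j′ mod m
  ≡-mod-* {i} {i′} {j} {j′} (≡-mod m∣i-i′) (≡-mod m∣j-j′) =
    ≡-mod (subst (+ m ∣_) (sym (lemma i i′ j j′)) (∣m∣n⇒∣m+n (∣n⇒∣m*n i m∣j-j′) (∣n⇒∣m*n j′ m∣i-i′)))
    where
    lemma : ∀ i i′ j j′ → i * j - i′ * j′ ≡ i * (j - j′) + j′ * (i - i′)
    lemma = solve-∀

  ≡-mod-^ : ∀ {i i′} → i ≡ i′ mod m → ∀ k → i ^ k ≡ i′ ^ k mod m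
  ≡-mod-^ i≡i′ zero    = ≡-mod (divides 0ℤ refl)
  ≡-mod-^ i≡i′ (suc k) = ≡-mod-* i≡i′ (≡-mod-^ i≡i′ k)

  ≡-mod-%ℕ : .{{_ : NonZero m}} → ∀ i → i ≡ + (i %ℕ m) mod m
  ≡-mod-%ℕ i = ≡-mod (divides (i /ℕ m) (begin
    i - + (i %ℕ m)                              ≡⟨ cong (_- + (i %ℕ m)) (a≡a%ℕn+[a/ℕn]*n i m) ⟩
    (+ (i %ℕ m) + i /ℕ m * + m) - + (i %ℕ m)    ≡⟨ lemma (+ (i %ℕ m)) (i /ℕ m * + m) ⟩
    i /ℕ m * + m                                ∎))
    where
    open ≡-Reasoning
    lemma : ∀ r k → (r + k) - r ≡ k
    lemma = solve-∀

fromℤ-+ : ∀ i j → fromℤ (i + j) ≡ fromℤ i ℚ.+ fromℤ j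
fromℤ-+ i j = ℚP.toℚᵘ-injective
  (ℚᵘP.≃-trans (ℚᵘ.*≡* (lemma i j)) (ℚᵘP.≃-sym (ℚP.toℚᵘ-homo-+ (fromℤ i) (fromℤ j))))
  where
  lemma : ∀ i j → (i + j) * 1ℤ ≡ (i * 1ℤ + j * 1ℤ) * 1ℤ
  lemma = solve-∀

fromℤ-* : ∀ i j → fromℤ (i * j) ≡ fromℤ i ℚ.* fromℤ j
fromℤ-* i j = ℚP.toℚᵘ-injective (ℚᵘP.≃-sym (ℚP.toℚᵘ-homo-* (fromℤ i) (fromℤ j)))

fromℤ-neg : ∀ i → fromℤ (ℤ.- i) ≡ ℚ.- fromℤ i
fromℤ-neg (+ zero)  = refl
fromℤ-neg +[1+ n ]  = refl
fromℤ-neg -[1+ n ]  = refl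

fromℤ-- : ∀ i j → fromℤ (i - j) ≡ fromℤ i ℚ.- fromℤ j
fromℤ-- i j = trans (fromℤ-+ i (ℤ.- j)) (cong (ℚ._+_ (fromℤ i)) (fromℤ-neg j))

q*↧q≡↥q : ∀ q → q ℚ.* fromℤ (↧ q) ≡ fromℤ (↥ q)
q*↧q≡↥q q@(mkℚ n d _) = ℚP.toℚᵘ-injective
  (ℚᵘP.≃-trans (ℚP.toℚᵘ-homo-* q (fromℤ (↧ q))) (ℚᵘ.*≡* (lemma n (+ suc d))))
  where
  lemma : ∀ n d → (n * d) * 1ℤ ≡ n * (d * 1ℤ)
  lemma = solve-∀

↥q↧q-coprime : ∀ q → Coprime (↥ q) (↧ q)
↥q↧q-coprime (mkℚ _ _ coprime) = ℕCoprimality.recompute coprime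

1/n*n≡1 : ∀ n .{{_ : NonZero n}} → (+ 1 / n) ℚ.* fromℤ (+ n) ≡ 1ℚ
1/n*n≡1 (suc m) = ℚP.toℚᵘ-injective
  (ℚᵘP.≃-trans (ℚP.toℚᵘ-homo-* (+ 1 / suc m) (fromℤ (+ suc m)))
  (ℚᵘP.≃-trans (ℚᵘP.*-congʳ (ℚP.toℚᵘ-fromℚᵘ (ℚᵘ.mkℚᵘ (+ 1) m))) (ℚᵘ.*≡* (lemma (+ suc m)))))
  where
  lemma : ∀ n → (1ℤ * n) * 1ℤ ≡ 1ℤ * (n * 1ℤ)
  lemma = solve-∀

1/n*[n*q]≡q : ∀ n .{{_ : NonZero n}} q → (+ 1 / n) ℚ.* (fromℤ (+ n) ℚ.* q) ≡ q
1/n*[n*q]≡q n q = begin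
  (+ 1 / n) ℚ.* (fromℤ (+ n) ℚ.* q) ≡⟨ ℚP.*-assoc (+ 1 / n) (fromℤ (+ n)) q ⟨
  ((+ 1 / n) ℚ.* fromℤ (+ n)) ℚ.* q ≡⟨ cong (ℚ._* q) (1/n*n≡1 n) ⟩
  1ℚ ℚ.* q                          ≡⟨ ℚP.*-identityˡ q ⟩
  q                                 ∎
  where open ≡-Reasoning

-- Any fraction with denominator prime to l, not necessarily in lowest terms: unlike InZₚ
-- this is visibly closed under the ring operations.
record ℤ₍_₎ (l : ℕ) (q : ℚ) : Set where
  constructor fraction
  field
    num den   : ℤ
    l∤den     : ¬ + l ∣ den
    q*den≡num : q ℚ.* fromℤ den ≡ fromℤ num

module _ {l : ℕ} (l-prime : Prime l) where

  ℤ₍₎-1 : ℤ₍ l ₎ 1ℚ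
  ℤ₍₎-1 = fraction 1ℤ 1ℤ (prime∤1 l-prime ∘ ∣⇒∣ᵤ) refl

  ℤ₍₎-+ : ∀ {q r} → ℤ₍ l ₎ q → ℤ₍ l ₎ r → ℤ₍ l ₎ (q ℚ.+ r)
  ℤ₍₎-+ {q} {r} (fraction a b l∤b q*b≡a) (fraction c d l∤d r*d≡c) =
    fraction (a * d + c * b) (b * d) (prime∤ℤ* l-prime l∤b l∤d) (begin
      (q ℚ.+ r) ℚ.* fromℤ (b * d)                     ≡⟨ cong ((q ℚ.+ r) ℚ.*_) (fromℤ-* b d) ⟩
      (q ℚ.+ r) ℚ.* (fromℤ b ℚ.* fromℤ d)             ≡⟨ lemma q r (fromℤ b) (fromℤ d) ⟩
      (q ℚ.* fromℤ b) ℚ.* fromℤ d ℚ.+ (r ℚ.* fromℤ d) ℚ.* fromℤ b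
        ≡⟨ cong₂ (λ x y → x ℚ.* fromℤ d ℚ.+ y ℚ.* fromℤ b) q*b≡a r*d≡c ⟩
      fromℤ a ℚ.* fromℤ d ℚ.+ fromℤ c ℚ.* fromℤ b
        ≡⟨ sym (trans (fromℤ-+ (a * d) (c * b)) (cong₂ ℚ._+_ (fromℤ-* a d) (fromℤ-* c b))) ⟩
      fromℤ (a * d + c * b)                           ∎)
    where
    open ≡-Reasoning
    lemma : ∀ q r x y → (q ℚ.+ r) ℚ.* (x ℚ.* y) ≡ (q ℚ.* x) ℚ.* y ℚ.+ (r ℚ.* y) ℚ.* x
    lemma = solve 4 (λ q r x y → (q :+ r) :* (x :* y) := (q :* x) :* y :+ (r :* y) :* x) refl

  ℤ₍₎-neg : ∀ {q} → ℤ₍ l ₎ q → ℤ₍ l ₎ (ℚ.- q)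
  ℤ₍₎-neg {q} (fraction a b l∤b q*b≡a) = fraction (ℤ.- a) b l∤b (begin
    (ℚ.- q) ℚ.* fromℤ b ≡⟨ ℚP.neg-distribˡ-* q (fromℤ b) ⟨
    ℚ.- (q ℚ.* fromℤ b) ≡⟨ cong ℚ.-_ q*b≡a ⟩
    ℚ.- fromℤ a         ≡⟨ fromℤ-neg a ⟨
    fromℤ (ℤ.- a)       ∎)
    where open ≡-Reasoning

  ℤ₍₎-* : ∀ {q r} → ℤ₍ l ₎ q → ℤ₍ l ₎ r → ℤ₍ l ₎ (q ℚ.* r)
  ℤ₍₎-* {q} {r} (fraction a b l∤b q*b≡a) (fraction c d l∤d r*d≡c) =
    fraction (a * c) (b * d) (prime∤ℤ* l-prime l∤b l∤d) (begin
      (q ℚ.* r) ℚ.* fromℤ (b * d)             ≡⟨ cong ((q ℚ.* r) ℚ.*_) (fromℤ-* b d) ⟩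
      (q ℚ.* r) ℚ.* (fromℤ b ℚ.* fromℤ d)     ≡⟨ interchange q r (fromℤ b) (fromℤ d) ⟩
      (q ℚ.* fromℤ b) ℚ.* (r ℚ.* fromℤ d)     ≡⟨ cong₂ ℚ._*_ q*b≡a r*d≡c ⟩
      fromℤ a ℚ.* fromℤ c                     ≡⟨ fromℤ-* a c ⟨
      fromℤ (a * c)                           ∎)
    where open ≡-Reasoning

InZγ⊆ℤ₍₎ : ∀ {p} .{{_ : NonZero p}} {l} → Prime l →
           (∀ x h → ℤ₍ l ₎ (γ p x h)) → ∀ {q} → InZγ p q → ℤ₍ l ₎ q
InZγ⊆ℤ₍₎ l-prime γ∈ (gen x h) = γ∈ x h
InZγ⊆ℤ₍₎ l-prime γ∈ one       = ℤ₍₎-1 l-prime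
InZγ⊆ℤ₍₎ l-prime γ∈ (add a b) = ℤ₍₎-+ l-prime (InZγ⊆ℤ₍₎ l-prime γ∈ a) (InZγ⊆ℤ₍₎ l-prime γ∈ b)
InZγ⊆ℤ₍₎ l-prime γ∈ (neg a)   = ℤ₍₎-neg l-prime (InZγ⊆ℤ₍₎ l-prime γ∈ a)
InZγ⊆ℤ₍₎ l-prime γ∈ (mul a b) = ℤ₍₎-* l-prime (InZγ⊆ℤ₍₎ l-prime γ∈ a) (InZγ⊆ℤ₍₎ l-prime γ∈ b)

ℤ₍₎⇒InZₚ : ∀ {l} q → ℤ₍ l ₎ q → InZₚ l q
ℤ₍₎⇒InZₚ q (fraction a b l∤b q*b≡a) l∣↧q =
  l∤b (∣ᵤ⇒∣ (ℕ∣.∣-trans l∣↧q ↧q∣b))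
  where
  ↥q*b≡a*↧q : ↥ q * b ≡ a * ↧ q
  ↥q*b≡a*↧q = cong ↥_ (begin
    fromℤ (↥ q * b)                     ≡⟨ fromℤ-* (↥ q) b ⟩
    fromℤ (↥ q) ℚ.* fromℤ b             ≡⟨ cong (ℚ._* fromℤ b) (q*↧q≡↥q q) ⟨
    (q ℚ.* fromℤ (↧ q)) ℚ.* fromℤ b     ≡⟨ xy∙z≈xz∙y q (fromℤ (↧ q)) (fromℤ b) ⟩
    (q ℚ.* fromℤ b) ℚ.* fromℤ (↧ q)     ≡⟨ cong (ℚ._* fromℤ (↧ q)) q*b≡a ⟩
    fromℤ a ℚ.* fromℤ (↧ q)             ≡⟨ fromℤ-* a (↧ q) ⟨
    fromℤ (a * ↧ q)                     ∎)
    where open ≡-Reasoning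
  ↧q∣b : ↧ₙ q ℕ∣.∣ ℤ.∣ b ∣
  ↧q∣b = coprime-divisor (↧ q) (↥ q) b (ℕCoprimality.sym (↥q↧q-coprime q)) (∣⇒∣ᵤ (divides a ↥q*b≡a*↧q))

Uₚ : ℕ → ℤ → ℤ → ℤ
Uₚ p n d = n ^ p - n * d ^ (p ∸ 1)

Dₚ : ℕ → ℤ → ℤ
Dₚ p d = d ^ p

Wₚ : ℕ → ℤ → ℤ → ℤ
Wₚ p n d = Uₚ p n d * Uₚ p n d - Dₚ p d * Dₚ p d

^ℚ-clear : ∀ x {n d} → x ℚ.* fromℤ d ≡ fromℤ n → ∀ k → (x ^ℚ k) ℚ.* fromℤ (d ^ k) ≡ fromℤ (n ^ k)
^ℚ-clear x         x*d≡n zero    = refl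
^ℚ-clear x {n} {d} x*d≡n (suc k) = begin
  (x ℚ.* (x ^ℚ k)) ℚ.* fromℤ (d * d ^ k)            ≡⟨ cong ((x ℚ.* (x ^ℚ k)) ℚ.*_) (fromℤ-* d (d ^ k)) ⟩
  (x ℚ.* (x ^ℚ k)) ℚ.* (fromℤ d ℚ.* fromℤ (d ^ k))  ≡⟨ interchange x (x ^ℚ k) (fromℤ d) (fromℤ (d ^ k)) ⟩
  (x ℚ.* fromℤ d) ℚ.* ((x ^ℚ k) ℚ.* fromℤ (d ^ k))  ≡⟨ cong₂ ℚ._*_ x*d≡n (^ℚ-clear x x*d≡n k) ⟩
  fromℤ n ℚ.* fromℤ (n ^ k)                         ≡⟨ fromℤ-* n (n ^ k) ⟨
  fromℤ (n * n ^ k)                                 ∎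
  where open ≡-Reasoning

module _ (q : ℕ) (x : ℚ) where

  private
    p = suc q
    n = ↥ x
    d = ↧ x
    u = uₚ p x
    U = Uₚ p n d
    D = Dₚ p d
    W = Wₚ p n d

  uₚ-clear : u ℚ.* fromℤ D ≡ fromℤ U
  uₚ-clear = begin
    ((x ^ℚ p) ℚ.- x) ℚ.* fromℤ (d * d ^ q)
      ≡⟨ cong (((x ^ℚ p) ℚ.- x) ℚ.*_) (fromℤ-* d (d ^ q)) ⟩
    ((x ^ℚ p) ℚ.- x) ℚ.* (fromℤ d ℚ.* fromℤ (d ^ q))
      ≡⟨ lemma (x ^ℚ p) x (fromℤ d) (fromℤ (d ^ q)) ⟩
    (x ^ℚ p) ℚ.* (fromℤ d ℚ.* fromℤ (d ^ q)) ℚ.- (x ℚ.* fromℤ d) ℚ.* fromℤ (d ^ q)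
      ≡⟨ cong₂ (λ a b → (x ^ℚ p) ℚ.* a ℚ.- b ℚ.* fromℤ (d ^ q)) (sym (fromℤ-* d (d ^ q))) (q*↧q≡↥q x) ⟩
    (x ^ℚ p) ℚ.* fromℤ D ℚ.- fromℤ n ℚ.* fromℤ (d ^ q)
      ≡⟨ cong₂ ℚ._-_ (^ℚ-clear x (q*↧q≡↥q x) p) (sym (fromℤ-* n (d ^ q))) ⟩
    fromℤ (n ^ p) ℚ.- fromℤ (n * d ^ q)
      ≡⟨ fromℤ-- (n ^ p) (n * d ^ q) ⟨
    fromℤ U ∎
    where
    open ≡-Reasoning
    lemma : ∀ a b c e → (a ℚ.- b) ℚ.* (c ℚ.* e) ≡ a ℚ.* (c ℚ.* e) ℚ.- (b ℚ.* c) ℚ.* e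
    lemma = solve 4 (λ a b c e → (a :- b) :* (c :* e) := a :* (c :* e) :- (b :* c) :* e) refl

  denₚ-clear : denₚ p x ℚ.* fromℤ (D * D) ≡ fromℤ W
  denₚ-clear = begin
    (u ℚ.* u ℚ.- 1ℚ) ℚ.* fromℤ (D * D)
      ≡⟨ cong ((u ℚ.* u ℚ.- 1ℚ) ℚ.*_) (fromℤ-* D D) ⟩
    (u ℚ.* u ℚ.- 1ℚ) ℚ.* (fromℤ D ℚ.* fromℤ D)
      ≡⟨ lemma u (fromℤ D) ⟩
    (u ℚ.* fromℤ D) ℚ.* (u ℚ.* fromℤ D) ℚ.- fromℤ D ℚ.* fromℤ D
      ≡⟨ cong (λ a → a ℚ.* a ℚ.- fromℤ D ℚ.* fromℤ D) uₚ-clear ⟩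
    fromℤ U ℚ.* fromℤ U ℚ.- fromℤ D ℚ.* fromℤ D
      ≡⟨ trans (fromℤ-- (U * U) (D * D)) (cong₂ ℚ._-_ (fromℤ-* U U) (fromℤ-* D D)) ⟨
    fromℤ W ∎
    where
    open ≡-Reasoning
    lemma : ∀ u a → (u ℚ.* u ℚ.- 1ℚ) ℚ.* (a ℚ.* a) ≡ (u ℚ.* a) ℚ.* (u ℚ.* a) ℚ.- a ℚ.* a
    lemma = solve 2 (λ u a → (u :* u :- con 1ℚ) :* (a :* a) := (u :* a) :* (u :* a) :- a :* a) refl

  module _ (h : denₚ p x ≢ 0ℚ) where

    γ-clear : γ p x h ℚ.* fromℤ W ≡ (+ 1 / p) ℚ.* fromℤ (U * D)
    γ-clear = begin
      (c ℚ.* (u ℚ.* e)) ℚ.* fromℤ W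
        ≡⟨ cong ((c ℚ.* (u ℚ.* e)) ℚ.*_) denₚ-clear ⟨
      (c ℚ.* (u ℚ.* e)) ℚ.* (den ℚ.* fromℤ (D * D))
        ≡⟨ cong (λ a → (c ℚ.* (u ℚ.* e)) ℚ.* (den ℚ.* a)) (fromℤ-* D D) ⟩
      (c ℚ.* (u ℚ.* e)) ℚ.* (den ℚ.* (fromℤ D ℚ.* fromℤ D))
        ≡⟨ lemma c u e den (fromℤ D) ⟩
      (c ℚ.* ((u ℚ.* fromℤ D) ℚ.* fromℤ D)) ℚ.* (den ℚ.* e)
        ≡⟨ cong₂ (λ a b → (c ℚ.* (a ℚ.* fromℤ D)) ℚ.* b) uₚ-clear (ℚP.*-inverseʳ den {{≢-nonZero h}}) ⟩
      (c ℚ.* (fromℤ U ℚ.* fromℤ D)) ℚ.* 1ℚ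
        ≡⟨ ℚP.*-identityʳ _ ⟩
      c ℚ.* (fromℤ U ℚ.* fromℤ D)
        ≡⟨ cong (c ℚ.*_) (fromℤ-* U D) ⟨
      c ℚ.* fromℤ (U * D) ∎
      where
      open ≡-Reasoning
      c = + 1 / p
      den = denₚ p x
      e = (1/ den) {{≢-nonZero h}}
      lemma : ∀ c u e den a →
              (c ℚ.* (u ℚ.* e)) ℚ.* (den ℚ.* (a ℚ.* a)) ≡ (c ℚ.* ((u ℚ.* a) ℚ.* a)) ℚ.* (den ℚ.* e)
      lemma = solve 5 (λ c u e den a →
        (c :* (u :* e)) :* (den :* (a :* a)) := (c :* ((u :* a) :* a)) :* (den :* e)) refl

    γ∈ℤ₍p₎ : + p ∣ U * D → ¬ + p ∣ W → ℤ₍ p ₎ (γ p x h)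
    γ∈ℤ₍p₎ (divides k UD≡k*p) p∤W = fraction k W p∤W (begin
      γ p x h ℚ.* fromℤ W                     ≡⟨ γ-clear ⟩
      (+ 1 / p) ℚ.* fromℤ (U * D)             ≡⟨ cong (λ a → (+ 1 / p) ℚ.* fromℤ a) (trans UD≡k*p (ℤP.*-comm k (+ p))) ⟩
      (+ 1 / p) ℚ.* fromℤ (+ p * k)           ≡⟨ cong ((+ 1 / p) ℚ.*_) (fromℤ-* (+ p) k) ⟩
      (+ 1 / p) ℚ.* (fromℤ (+ p) ℚ.* fromℤ k) ≡⟨ 1/n*[n*q]≡q p (fromℤ k) ⟩
      fromℤ k                                 ∎)
      where open ≡-Reasoning

    γ∈ℤ₍l₎ : ∀ {l} → Prime l → ¬ + l ∣ + p → ¬ + l ∣ W → ℤ₍ l ₎ (γ p x h)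
    γ∈ℤ₍l₎ l-prime l∤p l∤W = fraction (U * D) (+ p * W) (prime∤ℤ* l-prime l∤p l∤W) (begin
      γ p x h ℚ.* fromℤ (+ p * W)                         ≡⟨ cong (γ p x h ℚ.*_) (fromℤ-* (+ p) W) ⟩
      γ p x h ℚ.* (fromℤ (+ p) ℚ.* fromℤ W)               ≡⟨ x∙yz≈y∙xz (γ p x h) (fromℤ (+ p)) (fromℤ W) ⟩
      fromℤ (+ p) ℚ.* (γ p x h ℚ.* fromℤ W)               ≡⟨ cong (fromℤ (+ p) ℚ.*_) γ-clear ⟩
      fromℤ (+ p) ℚ.* ((+ 1 / p) ℚ.* fromℤ (U * D))       ≡⟨ x∙yz≈y∙xz (fromℤ (+ p)) (+ 1 / p) (fromℤ (U * D)) ⟩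
      (+ 1 / p) ℚ.* (fromℤ (+ p) ℚ.* fromℤ (U * D))       ≡⟨ 1/n*[n*q]≡q p (fromℤ (U * D)) ⟩
      fromℤ (U * D)                                       ∎)
      where open ≡-Reasoning

module _ {l : ℕ} (l-prime : Prime l) (n d : ℤ) where

  ∣Uₚ⇒∤Wₚ : ∀ p → + l ∣ Uₚ p n d → ¬ + l ∣ d → ¬ + l ∣ Wₚ p n d
  ∣Uₚ⇒∤Wₚ p l∣U l∤d l∣W = l∤d (prime∣^⇒∣ l-prime d p (prime∣²⇒∣ l-prime D l∣D²))
    where
    U = Uₚ p n d
    D = Dₚ p d
    D²≡U²-W : ∀ U D → D * D ≡ U * U - (U * U - D * D)
    D²≡U²-W = solve-∀
    l∣D² : + l ∣ D * D
    l∣D² = subst (+ l ∣_) (sym (D²≡U²-W U D)) (∣m∣n⇒∣m-n (∣n⇒∣m*n U l∣U) l∣W)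

  ∤d⇒∣Uₚ : ∀ q → (∀ i → + l ∣ i ^ suc q - i) → ¬ + l ∣ d → + l ∣ Uₚ (suc q) n d
  ∤d⇒∣Uₚ q l∣iᵖ-i l∤d = prime∣i*j∧∤i⇒∣j l-prime l∣dU l∤d
    where
    dU≡d[nᵖ-n]-n[dᵖ-d] : ∀ d nᵖ n dᵖ⁻¹ → d * (nᵖ - n * dᵖ⁻¹) ≡ d * (nᵖ - n) - n * (d * dᵖ⁻¹ - d)
    dU≡d[nᵖ-n]-n[dᵖ-d] = solve-∀
    l∣dU : + l ∣ d * Uₚ (suc q) n d
    l∣dU = subst (+ l ∣_) (sym (dU≡d[nᵖ-n]-n[dᵖ-d] d (n ^ suc q) n (d ^ q)))
                 (∣m∣n⇒∣m-n (∣n⇒∣m*n d (l∣iᵖ-i n)) (∣n⇒∣m*n n (l∣iᵖ-i d)))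

  ∣d⇒∤Wₚ : ∀ q → Coprime n d → + l ∣ d → ¬ + l ∣ Wₚ (2+ q) n d
  ∣d⇒∤Wₚ q coprime l∣d l∣W = ¬prime[1] (subst Prime (coprime (∣⇒∣ᵤ l∣n , ∣⇒∣ᵤ l∣d)) l-prime)
    where
    p = 2+ q
    U = Uₚ p n d
    D = Dₚ p d
    U²≡W+D² : ∀ U D → U * U ≡ (U * U - D * D) + D * D
    U²≡W+D² = solve-∀
    nᵖ≡U+ndᵖ⁻¹ : ∀ nᵖ n dᵖ⁻¹ → nᵖ ≡ (nᵖ - n * dᵖ⁻¹) + n * dᵖ⁻¹
    nᵖ≡U+ndᵖ⁻¹ = solve-∀
    l∣U : + l ∣ U
    l∣U = prime∣²⇒∣ l-prime U (subst (+ l ∣_) (sym (U²≡W+D² U D))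
      (∣m∣n⇒∣m+n l∣W (∣n⇒∣m*n D (∣m⇒∣m*n (d ^ suc q) l∣d))))
    l∣n : + l ∣ n
    l∣n = prime∣^⇒∣ l-prime n p (subst (+ l ∣_) (sym (nᵖ≡U+ndᵖ⁻¹ (n ^ p) n (d ^ suc q)))
      (∣m∣n⇒∣m+n l∣U (∣n⇒∣m*n n (∣m⇒∣m*n (d ^ q) l∣d))))

  ∣Uₚ*Dₚ∧∤Wₚ : ∀ q → (∀ i → + l ∣ i ^ 2+ q - i) → Coprime n d →
               + l ∣ Uₚ (2+ q) n d * Dₚ (2+ q) d × ¬ + l ∣ Wₚ (2+ q) n d
  ∣Uₚ*Dₚ∧∤Wₚ q l∣iᵖ-i coprime with + l ∣? d
  ... | yes l∣d = ∣n⇒∣m*n (Uₚ (2+ q) n d) (∣m⇒∣m*n (d ^ suc q) l∣d) , ∣d⇒∤Wₚ q coprime l∣d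
  ... | no  l∤d = ∣m⇒∣m*n (Dₚ (2+ q) d) l∣U , ∣Uₚ⇒∤Wₚ (2+ q) l∣U l∤d
    where l∣U = ∤d⇒∣Uₚ (suc q) l∣iᵖ-i l∤d

Wₚ-cong : ∀ {m n n′ d d′} p → n ≡ n′ mod m → d ≡ d′ mod m → Wₚ p n d ≡ Wₚ p n′ d′ mod m
Wₚ-cong p n≡n′ d≡d′ = ≡-mod-- (≡-mod-* U≡U′ U≡U′) (≡-mod-* D≡D′ D≡D′)
  where
  D≡D′ = ≡-mod-^ d≡d′ p
  U≡U′ = ≡-mod-- (≡-mod-^ n≡n′ p) (≡-mod-* n≡n′ (≡-mod-^ d≡d′ (p ∸ 1)))

prime[17] : Prime 17
prime[17] = from-yes (prime? 17)

-- For p = 2, Wₚ factors as (n² - nd - d²)(n² - nd + d²); neither factor vanishes mod 17 when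
-- 17 ∤ d, because the discriminants 5 and -3 are quadratic non-residues mod 17.
W₂-mod-17 : ∀ {r} → r < 17 → ∀ {s} → s < 17 → ¬ + 17 ∣ + s → ¬ + 17 ∣ Wₚ 2 (+ r) (+ s)
W₂-mod-17 = toWitness {a? = ℕP.allUpTo? (λ r → ℕP.allUpTo? (λ s →
  ¬? (+ 17 ∣? + s) →-dec ¬? (+ 17 ∣? Wₚ 2 (+ r) (+ s))) 17) 17} _

17∤W₂ : ∀ n d → Coprime n d → ¬ + 17 ∣ Wₚ 2 n d
17∤W₂ n d coprime with + 17 ∣? d
... | yes 17∣d = ∣d⇒∤Wₚ prime[17] n d 0 coprime 17∣d
... | no  17∤d = W₂-mod-17 (n%ℕd<d n 17) (n%ℕd<d d 17) (17∤d ∘ ≡-mod-∣ (≡-mod-sym d≡s))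
               ∘ ≡-mod-∣ (Wₚ-cong 2 (≡-mod-%ℕ n) d≡s)
  where d≡s = ≡-mod-%ℕ d

InZγₚ⊆InZₚ : ∀ q → Prime (2+ q) → ∀ {r} → InZγ (2+ q) r → InZₚ (2+ q) r
InZγₚ⊆InZₚ q p-prime {r} = ℤ₍₎⇒InZₚ r ∘ InZγ⊆ℤ₍₎ p-prime (λ x h → uncurry (γ∈ℤ₍p₎ (suc q) x h)
  (∣Uₚ*Dₚ∧∤Wₚ p-prime (↥ x) (↧ x) q (fermat'sLittleTheorem p-prime) (↥q↧q-coprime x)))

InZγₚ⊆InZₗ : ∀ q {l} → Prime l → ¬ + l ∣ + suc q → (∀ n d → Coprime n d → ¬ + l ∣ Wₚ (suc q) n d) →
             ∀ {r} → InZγ (suc q) r → InZₚ l r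
InZγₚ⊆InZₗ q l-prime l∤p l∤W {r} =
  ℤ₍₎⇒InZₚ r ∘ InZγ⊆ℤ₍₎ l-prime (λ x h → γ∈ℤ₍l₎ q x h l-prime l∤p (l∤W (↥ x) (↧ x) (↥q↧q-coprime x)))

1/17∉InZγ₂ : ¬ InZγ 2 (+ 1 / 17)
1/17∉InZγ₂ z = InZγₚ⊆InZₗ 1 prime[17] (toWitnessFalse {a? = + 17 ∣? + 2} _) 17∤W₂ z ℕ∣.∣-refl

1/2∉InZγₚ : ∀ q → Prime (2+ (suc q)) → ¬ InZγ (2+ (suc q)) (+ 1 / 2)
1/2∉InZγₚ q p-prime z = InZγₚ⊆InZₗ (2+ q) prime[2] 2∤p 2∤W z ℕ∣.∣-refl
  where
  2∤p : ¬ + 2 ∣ + (2+ (suc q))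
  2∤p 2∣p = [ (λ ()) , (λ ()) ]′ (prime⇒irreducible p-prime (∣⇒∣ᵤ 2∣p))
  2∤W : ∀ n d → Coprime n d → ¬ + 2 ∣ Wₚ (2+ (suc q)) n d
  2∤W n d = proj₂ ∘ ∣Uₚ*Dₚ∧∤Wₚ prime[2] n d (suc q) (2∣i^[1+k]-i (2+ q))

proposition2p8 : (p : ℕ) .{{_ : NonZero p}} → Prime p →
    ((q : ℚ) → InZγ p q → InZₚ p q) × ∃ (λ q → InZₚ p q × ¬ InZγ p q)
proposition2p8 (2+ q) p-prime = (λ _ → InZγₚ⊆InZₚ q p-prime) , nonmember q p-prime
  where
  nonmember : ∀ q → Prime (2+ q) → ∃ λ r → InZₚ (2+ q) r × ¬ InZγ (2+ q) r
  nonmember zero    _       = + 1 / 17 , toWitnessFalse {a? = 2 ℕ∣.∣? 17} _ , 1/17∉InZγ₂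
  nonmember (suc q) p-prime = + 1 / 2 , (λ p∣2 → ℕP.<⇒≱ (ℕ.s≤s (ℕ.s≤s (ℕ.s≤s ℕ.z≤n))) (ℕ∣.∣⇒≤ p∣2)) ,
                              1/2∉InZγₚ q p-prime
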